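{- Let $V=[n]$, let $\mathbb V=\{V_1,\dots,V_k\}$ be a partition of $V$, let $d:\mathbb V\to\mathbb N$, and let $D^*=(d_{ij})$ be a symmetric $k\times k$ matrix with entries in $\mathbb N_0\cup\{*\}$. If $\langle\mathbb V,d,D^*\rangle\neq\emptyset$, then there exists a balanced $\langle\mathbb V,d,D^*\rangle$ graph.
   Context: $\langle\mathbb V,d,D^*\rangle$ denotes the set of simple graphs $G$ on $V$ such that every vertex of $V_i$ has degree $d(V_i)$ for every $i$, and for every $i\ne j$ with $d_{ij}\neq *$ there are exactly $d_{ij}$ edges between $V_i$ and $V_j$, and for every $i$ with $d_{ii}\ne *$ there are exactly $d_{ii}$ edges with both endpoints in $V_i$; entries equal to $*$ impose no restriction. A graph $G\in\langle\mathbb V,d,D^*\rangle$ is balanced if the subgraph $H$ with vertex set $V$ and edge set $\{uv\in E(G): u\in V_i, v\in V_j, d_{ij}\neq *\}$ satisfies the balanced degree invariant, i.e. for every $i$, $\max_{v\in V_i}\deg_H(v)-\min_{v\in V_i}\deg_H(v)\le 1$. -}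

module Defs where

open import Data.Nat using (ℕ; zero; suc; _+_; _≤_; _<_)
open import Data.Bool using (Bool; true; false; _∧_; _∨_; if_then_else_)
open import Data.Fin using (Fin; toℕ)
open import Data.Fin.Properties using (_≟_)
open import Data.Nat.Properties using (_<?_)
open import Data.Maybe using (Maybe; just; nothing; is-just)
open import Data.Product using (Σ; _×_; ∃)
open import Relation.Nullary.Decidable using (⌊_⌋)
open import Relation.Binary.PropositionalEquality using (_≡_)

count : (n : ℕ) → (Fin n → Bool) → ℕ
count zero    p = 0
count (suc n) p = (if p Fin.zero then 1 else 0) + count n (λ x → p (Fin.suc x))

sumFin : (n : ℕ) → (Fin n → ℕ) → ℕ
sumFin zero    f = 0
sumFin (suc n) f = f Fin.zero + sumFin n (λ x → f (Fin.suc x))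

record Graph (n : ℕ) : Set where
  field
    adj    : Fin n → Fin n → Bool
    sym    : ∀ u v → adj u v ≡ adj v u
    irrefl : ∀ u → adj u u ≡ false
open Graph public

degree : {n : ℕ} → Graph n → Fin n → ℕ
degree {n} G v = count n (λ u → adj G v u)

-- Entries of D*: `just m` is the number m ∈ ℕ₀, `nothing` is the symbol *.
Matrix* : ℕ → Set
Matrix* k = Fin k → Fin k → Maybe ℕ

-- The partition 𝕍 = {V_1,…,V_k} of Fin n is given by the block map part : Fin n → Fin k
-- (V_i = part⁻¹(i)).
module _ {n k : ℕ} (part : Fin n → Fin k) where

  -- number of edges uv (counted once, as unordered pairs u < v) with one endpoint
  -- in V_i and the other in V_j; for i = j these are the edges inside V_i
  edgesBetween : Graph n → Fin k → Fin k → ℕ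
  edgesBetween G i j =
    sumFin n (λ u → count n (λ v →
      ⌊ toℕ u <? toℕ v ⌋ ∧ adj G u v ∧
      ((⌊ part u ≟ i ⌋ ∧ ⌊ part v ≟ j ⌋) ∨ (⌊ part u ≟ j ⌋ ∧ ⌊ part v ≟ i ⌋))))


  InClass : (Fin k → ℕ) → Matrix* k → Graph n → Set
  InClass d D G =
    (∀ v → degree G v ≡ d (part v)) ×
    (∀ i j m → D i j ≡ just m → edgesBetween G i j ≡ m)

  -- degree of v in the subgraph H keeping only edges between blocks i,j with d_ij ≠ *
  degreeH : Matrix* k → Graph n → Fin n → ℕ
  degreeH D G v = count n (λ u → adj G v u ∧ is-just (D (part v) (part u)))

  Balanced : Matrix* k → Graph n → Set
  Balanced D G = ∀ u v → part u ≡ part v → degreeH D G u ≤ suc (degreeH D G v)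

-- Among the graphs of ⟨𝕍,d,D*⟩ take one minimising Φ(G) = Σ_v deg_H(v)².  If it is not
-- balanced, some u, v in one block have deg_H(u) ≥ deg_H(v) + 2.  Since deg_G(u) = deg_G(v),
-- u has an H-neighbour w that is not adjacent to v, and v has a neighbour x outside H that is
-- not adjacent to u.  The switch uw, vx ↦ vw, ux keeps every degree and, as u and v lie in the
-- same block, every count d_ij; it moves one H-edge from u to v, so Φ drops by at least 2.
module Submission where

open import Algebra.Bundles using (CommutativeMonoid)
open import Data.Bool using (Bool; true; false; _∧_; _∨_; not; if_then_else_)
open import Data.Bool.Properties
  using (∧-comm; ∨-comm; ∧-identityʳ; ∧-zeroʳ; ∧-conicalˡ; ∧-conicalʳ; not-injective; ∧-commutativeMonoid)
open import Algebra.Properties.CommutativeSemigroup (CommutativeMonoid.commutativeSemigroup ∧-commutativeMonoid)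
  using (x∙yz≈y∙xz)
open import Data.Empty using (⊥-elim)
open import Data.Fin using (Fin; zero; suc; punchIn; toℕ)
open import Data.Fin.Properties using (_≟_; punchInᵢ≢i; toℕ-injective; all?; ¬∀⟶∃¬)
open import Data.Maybe using (is-just)
open import Data.Nat using (ℕ; zero; suc; _+_; _*_; _≤_; _<_; z≤n; s≤s⁻¹)
open import Data.Nat.Induction using (<-wellFounded)
open import Data.Nat.Properties
  using ( +-0-commutativeMonoid; +-identityʳ; +-cancelʳ-≡; +-cancelˡ-≤; +-cancelʳ-≤; +-monoˡ-≤
        ; +-monoʳ-≤; *-monoʳ-≤; ≤-refl; ≤-reflexive; ≤-trans; ≤-antisym; n≤1+n; 1+n≰n; ≰⇒>
        ; ≮⇒≥; <-asym; _≤?_; _<?_; module ≤-Reasoning)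
open import Algebra.Properties.CommutativeMonoid.Sum +-0-commutativeMonoid
  using (sum; sum-cong-≗; ∑-distrib-+; sum-remove; sum-replicate-zero)
open import Data.Nat.Tactic.RingSolver using (solve-∀)
open import Data.Product using (∃; _×_; _,_; map)
open import Data.Sum using (_⊎_; inj₁; inj₂)
open import Function using (id; _∘_)
open import Induction.WellFounded using (Acc; acc)
open import Relation.Nullary using (Dec; yes; no)
open import Relation.Nullary.Decidable using (⌊_⌋; isYes≗does; dec-true; dec-false; _→-dec_)
open import Relation.Binary.PropositionalEquality
  using (_≡_; _≢_; refl; sym; trans; cong; cong₂; module ≡-Reasoning)

open import Defs hiding (sym)

⟦_⟧ : Bool → ℕ
⟦ b ⟧ = if b then 1 else 0

⟦⟧≤1 : ∀ b → ⟦ b ⟧ ≤ 1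
⟦⟧≤1 true  = ≤-refl
⟦⟧≤1 false = z≤n

_==_ : ∀ {n} → Fin n → Fin n → Bool
a == b = ⌊ a ≟ b ⌋

==-refl : ∀ {n} (a : Fin n) → a == a ≡ true
==-refl a = trans (isYes≗does (a ≟ a)) (dec-true (a ≟ a) refl)

==-≢ : ∀ {n} {a b : Fin n} → a ≢ b → a == b ≡ false
==-≢ {a = a} {b} a≢b = trans (isYes≗does (a ≟ b)) (dec-false (a ≟ b) a≢b)

==⇒≡ : ∀ {n} {a b : Fin n} → a == b ≡ true → a ≡ b
==⇒≡ {a = a} {b} _ with a ≟ b
... | yes a≡b = a≡b

not-==⇒≢ : ∀ {n} {a b : Fin n} → not (a == b) ≡ true → a ≢ b
not-==⇒≢ {a = a} a≠b refl with trans (sym (cong not (==-refl a))) a≠b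
... | ()

∧-==-at : ∀ {n} (g : Fin n → Bool) (a z : Fin n) → (a == z ∧ g a) ≡ (a == z ∧ g z)
∧-==-at g a z with a ≟ z
... | yes refl = refl
... | no  _    = refl

∧-≡false : ∀ {x y} → y ≡ true → x ∧ y ≡ false → x ≡ false
∧-≡false {x} refl x∧y≡false = trans (sym (∧-identityʳ x)) x∧y≡false

∨-elim : ∀ {a} {A : Set a} {x y : Bool} → (x ≡ true → A) → (y ≡ true → A) → x ∨ y ≡ true → A
∨-elim {x = true}  l r _ = l refl
∨-elim {x = false} l r h = r h

count≡sum : ∀ n (p : Fin n → Bool) → count n p ≡ sum (λ a → ⟦ p a ⟧)
count≡sum zero    p = refl
count≡sum (suc n) p = cong (⟦ p zero ⟧ +_) (count≡sum n (λ a → p (suc a)))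

sumFin≡sum : ∀ n (f : Fin n → ℕ) → sumFin n f ≡ sum f
sumFin≡sum zero    f = refl
sumFin≡sum (suc n) f = cong (f zero +_) (sumFin≡sum n (λ a → f (suc a)))

sum-supported : ∀ {n} (f : Fin n → ℕ) (i : Fin n) → (∀ j → j ≢ i → f j ≡ 0) → sum f ≡ f i
sum-supported {suc n} f i f≡0 = trans (sum-remove {i = i} f) (trans
  (cong (f i +_) (trans (sum-cong-≗ (λ j → f≡0 (punchIn i j) (punchInᵢ≢i i j))) (sum-replicate-zero n)))
  (+-identityʳ (f i)))

sum-δ : ∀ {n} (z : Fin n) (m : ℕ) → sum (λ a → if a == z then m else 0) ≡ m
sum-δ z m = trans (sum-supported _ z (λ a a≢z → cong (λ t → if t then m else 0) (==-≢ a≢z)))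
                  (cong (λ t → if t then m else 0) (==-refl z))

sum-==-∧ : ∀ {n} (z : Fin n) (t : Bool) → sum (λ a → ⟦ a == z ∧ t ⟧) ≡ ⟦ t ⟧
sum-==-∧ z t = trans (sum-supported _ z (λ a a≢z → cong (λ s → ⟦ s ∧ t ⟧) (==-≢ a≢z)))
                     (cong (λ s → ⟦ s ∧ t ⟧) (==-refl z))

count-split : ∀ n (p q : Fin n → Bool) →
              count n p ≡ count n (λ b → p b ∧ q b) + count n (λ b → p b ∧ not (q b))
count-split n p q = begin
  count n p
    ≡⟨ count≡sum n p ⟩
  sum (λ b → ⟦ p b ⟧)
    ≡⟨ sum-cong-≗ (λ b → split (p b) (q b)) ⟩
  sum (λ b → ⟦ p b ∧ q b ⟧ + ⟦ p b ∧ not (q b) ⟧)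
    ≡⟨ ∑-distrib-+ (λ b → ⟦ p b ∧ q b ⟧) (λ b → ⟦ p b ∧ not (q b) ⟧) ⟩
  sum (λ b → ⟦ p b ∧ q b ⟧) + sum (λ b → ⟦ p b ∧ not (q b) ⟧)
    ≡⟨ cong₂ _+_ (count≡sum n _) (count≡sum n _) ⟨
  count n (λ b → p b ∧ q b) + count n (λ b → p b ∧ not (q b)) ∎
  where
  open ≡-Reasoning
  split : ∀ x y → ⟦ x ⟧ ≡ ⟦ x ∧ y ⟧ + ⟦ x ∧ not y ⟧
  split true  true  = refl
  split true  false = refl
  split false _     = refl

count-∧-==-≤1 : ∀ n (p : Fin n → Bool) (z : Fin n) → count n (λ b → p b ∧ b == z) ≤ 1
count-∧-==-≤1 n p z = ≤-trans (≤-reflexive (trans (count≡sum n _) (sum-supported _ z vanish)))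
                              (⟦⟧≤1 (p z ∧ z == z))
  where
  vanish : ∀ b → b ≢ z → ⟦ p b ∧ b == z ⟧ ≡ 0
  vanish b b≢z = cong ⟦_⟧ (trans (cong (p b ∧_) (==-≢ b≢z)) (∧-zeroʳ (p b)))

count-<⇒∃ : ∀ n (p q : Fin n → Bool) → count n q < count n p → ∃ λ b → p b ≡ true × q b ≡ false
count-<⇒∃ (suc n) p q q<p with p zero in p₀ | q zero in q₀
... | true  | false = zero , p₀ , q₀
... | true  | true  = map suc id (count-<⇒∃ n (p ∘ suc) (q ∘ suc) (s≤s⁻¹ q<p))
... | false | false = map suc id (count-<⇒∃ n (p ∘ suc) (q ∘ suc) q<p)
... | false | true  = map suc id (count-<⇒∃ n (p ∘ suc) (q ∘ suc) (≤-trans (n≤1+n _) q<p))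

count-gap⇒∃ : ∀ n (p q : Fin n → Bool) (z : Fin n) → 2 + count n q ≤ count n p →
              ∃ λ b → p b ≡ true × q b ≡ false × b ≢ z
count-gap⇒∃ n p q z gap with count-<⇒∃ n (λ b → p b ∧ not (b == z)) q q<p∖z
  where
  q<p∖z : count n q < count n (λ b → p b ∧ not (b == z))
  q<p∖z = s≤s⁻¹ (≤-trans gap (≤-trans (≤-reflexive (count-split n p (_== z)))
                                      (+-monoˡ-≤ _ (count-∧-==-≤1 n p z))))
... | b , pb∧b≠z , qb = b , ∧-conicalˡ _ _ pb∧b≠z , qb , not-==⇒≢ (∧-conicalʳ _ _ pb∧b≠z)

-- The hypothesis says that f′ arises from f by moving one unit from u to v.
sum-sq-transfer-identity : ∀ {n} (f f′ : Fin n → ℕ) {u v : Fin n} → u ≢ v →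
                           (∀ a → f′ a + ⟦ a == u ⟧ ≡ f a + ⟦ a == v ⟧) →
                           sum (λ a → f′ a * f′ a) + 2 * f u ≡ sum (λ a → f a * f a) + 2 * (1 + f v)
sum-sq-transfer-identity f f′ {u} {v} u≢v transfer = begin
  sum (λ a → f′ a * f′ a) + 2 * f u
    ≡⟨ cong (sum (λ a → f′ a * f′ a) +_) (sum-δ u (2 * f u)) ⟨
  sum (λ a → f′ a * f′ a) + sum (λ a → if a == u then 2 * f u else 0)
    ≡⟨ ∑-distrib-+ (λ a → f′ a * f′ a) (λ a → if a == u then 2 * f u else 0) ⟨
  sum (λ a → f′ a * f′ a + (if a == u then 2 * f u else 0))
    ≡⟨ sum-cong-≗ point ⟩
  sum (λ a → f a * f a + (⟦ a == u ⟧ + (if a == v then 2 * f v + 1 else 0)))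
    ≡⟨ ∑-distrib-+ (λ a → f a * f a) (λ a → ⟦ a == u ⟧ + (if a == v then 2 * f v + 1 else 0)) ⟩
  sum (λ a → f a * f a) + sum (λ a → ⟦ a == u ⟧ + (if a == v then 2 * f v + 1 else 0))
    ≡⟨ cong (sum (λ a → f a * f a) +_) (trans
         (∑-distrib-+ (λ a → ⟦ a == u ⟧) (λ a → if a == v then 2 * f v + 1 else 0))
         (cong₂ _+_ (sum-δ u 1) (sum-δ v (2 * f v + 1)))) ⟩
  sum (λ a → f a * f a) + (1 + (2 * f v + 1))
    ≡⟨ cong (sum (λ a → f a * f a) +_) (regroup (f v)) ⟩
  sum (λ a → f a * f a) + 2 * (1 + f v) ∎
  where
  open ≡-Reasoning
  regroup : ∀ m → 1 + (2 * m + 1) ≡ 2 * (1 + m)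
  regroup = solve-∀
  square-up : ∀ m → m * m + 2 * (m + 1) ≡ (m + 1) * (m + 1) + (1 + 0)
  square-up = solve-∀
  square-down : ∀ m → (m + 1) * (m + 1) + 0 ≡ m * m + (0 + (2 * m + 1))
  square-down = solve-∀

  point : ∀ a → f′ a * f′ a + (if a == u then 2 * f u else 0)
              ≡ f a * f a + (⟦ a == u ⟧ + (if a == v then 2 * f v + 1 else 0))
  point a with a ≟ u | a ≟ v | transfer a
  ... | yes a≡u  | yes a≡v  | _ = ⊥-elim (u≢v (trans (sym a≡u) a≡v))
  ... | yes refl | no  _    | t rewrite trans (sym (+-identityʳ (f a))) (sym t) = square-up (f′ a)
  ... | no  _    | yes refl | t rewrite trans (sym (+-identityʳ (f′ a))) t = square-down (f a)
  ... | no  _    | no  _    | t rewrite +-cancelʳ-≡ 0 (f′ a) (f a) t = refl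

sum-sq-transfer : ∀ {n} (f f′ : Fin n → ℕ) {u v : Fin n} →
                  (∀ a → f′ a + ⟦ a == u ⟧ ≡ f a + ⟦ a == v ⟧) → 2 + f v ≤ f u →
                  sum (λ a → f′ a * f′ a) < sum (λ a → f a * f a)
sum-sq-transfer f f′ {u} {v} transfer gap =
  ≤-trans (n≤1+n _) (+-cancelʳ-≤ (2 * (1 + f v)) (2 + Φ′) Φ (begin
    2 + Φ′ + 2 * (1 + f v)   ≡⟨ shift Φ′ (f v) ⟩
    Φ′ + 2 * (2 + f v)       ≤⟨ +-monoʳ-≤ Φ′ (*-monoʳ-≤ 2 gap) ⟩
    Φ′ + 2 * f u             ≡⟨ sum-sq-transfer-identity f f′ u≢v transfer ⟩
    Φ + 2 * (1 + f v)        ∎))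
  where
  open ≤-Reasoning
  Φ Φ′ : ℕ
  Φ  = sum (λ a → f a * f a)
  Φ′ = sum (λ a → f′ a * f′ a)

  shift : ∀ m k → 2 + m + 2 * (1 + k) ≡ m + 2 * (2 + k)
  shift = solve-∀

  u≢v : u ≢ v
  u≢v refl = 1+n≰n (≤-trans (n≤1+n _) gap)

complement-gap : ∀ {a b c d} → a + c ≡ b + d → 2 + b ≤ a → 2 + c ≤ d
complement-gap {a} {b} {c} {d} a+c≡b+d gap = +-cancelˡ-≤ b (2 + c) d (begin
  b + (2 + c)  ≡⟨ shift b c ⟩
  2 + b + c    ≤⟨ +-monoˡ-≤ c gap ⟩
  a + c        ≡⟨ a+c≡b+d ⟩
  b + d        ∎)
  where
  open ≤-Reasoning
  shift : ∀ m n → m + (2 + n) ≡ 2 + m + n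
  shift = solve-∀

-- Weighted row counts and edge exchanges

rowCount : ∀ {n} (E c : Fin n → Fin n → Bool) → Fin n → ℕ
rowCount E c a = sum (λ b → ⟦ E a b ∧ c a b ⟧)

degree≡rowCount : ∀ {n} (G : Graph n) a → degree G a ≡ rowCount (adj G) (λ _ _ → true) a
degree≡rowCount {n} G a =
  trans (count≡sum n (adj G a)) (sum-cong-≗ (λ b → cong ⟦_⟧ (sym (∧-identityʳ (adj G a b)))))

rowCount-∨ : ∀ {n} (E F c : Fin n → Fin n → Bool) a → (∀ b → E a b ∧ F a b ≡ false) →
             rowCount (λ a b → E a b ∨ F a b) c a ≡ rowCount E c a + rowCount F c a
rowCount-∨ E F c a disjoint =
  trans (sum-cong-≗ (λ b → split (E a b) (F a b) (c a b) (disjoint b)))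
        (∑-distrib-+ (λ b → ⟦ E a b ∧ c a b ⟧) (λ b → ⟦ F a b ∧ c a b ⟧))
  where
  split : ∀ x y z → x ∧ y ≡ false → ⟦ (x ∨ y) ∧ z ⟧ ≡ ⟦ x ∧ z ⟧ + ⟦ y ∧ z ⟧
  split true  false z _ = sym (+-identityʳ ⟦ z ⟧)
  split false y     z _ = refl

sum-rowCount-∨ : ∀ {n} (E F c : Fin n → Fin n → Bool) → (∀ a b → E a b ∧ F a b ≡ false) →
                 sum (rowCount (λ a b → E a b ∨ F a b) c) ≡ sum (rowCount E c) + sum (rowCount F c)
sum-rowCount-∨ E F c disjoint =
  trans (sum-cong-≗ (λ a → rowCount-∨ E F c a (disjoint a))) (∑-distrib-+ (rowCount E c) (rowCount F c))

adj⇒≢ : ∀ {n} (G : Graph n) {a b : Fin n} → adj G a b ≡ true → a ≢ b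
adj⇒≢ G {a} ab∈G refl with trans (sym (irrefl G a)) ab∈G
... | ()

pair : ∀ {n} → Fin n → Fin n → Fin n → Fin n → Bool
pair p q a b = (a == p ∧ b == q) ∨ (a == q ∧ b == p)

pair-sym : ∀ {n} (p q a b : Fin n) → pair p q a b ≡ pair p q b a
pair-sym p q a b = trans (cong₂ _∨_ (∧-comm (a == p) (b == q)) (∧-comm (a == q) (b == p)))
                         (∨-comm (b == q ∧ a == p) (b == p ∧ a == q))

pair-true : ∀ {n} {p q a b : Fin n} → pair p q a b ≡ true → (a ≡ p × b ≡ q) ⊎ (a ≡ q × b ≡ p)
pair-true {p = p} {q} {a} {b} h with a ≟ p | b ≟ q
... | yes a≡p | yes b≡q = inj₁ (a≡p , b≡q)
... | yes _   | no  _   = inj₂ (==⇒≡ (∧-conicalˡ _ _ h) , ==⇒≡ (∧-conicalʳ _ _ h))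
... | no  _   | yes _   = inj₂ (==⇒≡ (∧-conicalˡ _ _ h) , ==⇒≡ (∧-conicalʳ _ _ h))
... | no  _   | no  _   = inj₂ (==⇒≡ (∧-conicalˡ _ _ h) , ==⇒≡ (∧-conicalʳ _ _ h))

pair-irrefl : ∀ {n} {p q : Fin n} → p ≢ q → ∀ a → pair p q a a ≡ false
pair-irrefl {p = p} {q} p≢q a with pair p q a a in h
... | false = refl
... | true with pair-true {p = p} {q} {a} {a} h
...   | inj₁ (a≡p , a≡q) = ⊥-elim (p≢q (trans (sym a≡p) a≡q))
...   | inj₂ (a≡q , a≡p) = ⊥-elim (p≢q (trans (sym a≡p) a≡q))

pair-disjoint : ∀ {n} {p q r s : Fin n} → p ≢ r → p ≢ s → ∀ a b → pair p q a b ∧ pair r s a b ≡ false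
pair-disjoint {p = p} {q} {r} {s} p≢r p≢s a b with pair p q a b in h₁ | pair r s a b in h₂
... | false | _     = refl
... | true  | false = refl
... | true  | true  with pair-true {p = p} {q} {a} {b} h₁ | pair-true {p = r} {s} {a} {b} h₂
...   | inj₁ (a≡p , _) | inj₁ (a≡r , _) = ⊥-elim (p≢r (trans (sym a≡p) a≡r))
...   | inj₁ (a≡p , _) | inj₂ (a≡s , _) = ⊥-elim (p≢s (trans (sym a≡p) a≡s))
...   | inj₂ (_ , b≡p) | inj₁ (_ , b≡s) = ⊥-elim (p≢s (trans (sym b≡p) b≡s))
...   | inj₂ (_ , b≡p) | inj₂ (_ , b≡r) = ⊥-elim (p≢r (trans (sym b≡p) b≡r))

pair-⊆ : ∀ {n} (G : Graph n) {p q : Fin n} {t : Bool} → adj G p q ≡ t →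
         ∀ {a b} → pair p q a b ≡ true → adj G a b ≡ t
pair-⊆ G {p} {q} pq≡t {a} {b} h with pair-true {p = p} {q} {a} {b} h
... | inj₁ (refl , refl) = pq≡t
... | inj₂ (refl , refl) = trans (Graph.sym G q p) pq≡t

rowCount-pair : ∀ {n} {p q : Fin n} → p ≢ q → ∀ c a →
                rowCount (pair p q) c a ≡ ⟦ a == p ∧ c p q ⟧ + ⟦ a == q ∧ c q p ⟧
rowCount-pair {p = p} {q} p≢q c a =
  trans (rowCount-∨ (λ a b → a == p ∧ b == q) (λ a b → a == q ∧ b == p) c a disjoint)
        (cong₂ _+_ (column p q) (column q p))
  where
  open ≡-Reasoning
  disjoint : ∀ b → (a == p ∧ b == q) ∧ (a == q ∧ b == p) ≡ false
  disjoint b with a ≟ p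
  ... | no  _    = refl
  ... | yes refl rewrite ==-≢ p≢q = ∧-zeroʳ (b == q)

  column : ∀ s t → sum (λ b → ⟦ (a == s ∧ b == t) ∧ c a b ⟧) ≡ ⟦ a == s ∧ c s t ⟧
  column s t = begin
    sum (λ b → ⟦ (a == s ∧ b == t) ∧ c a b ⟧)
      ≡⟨ sum-supported _ t (λ b b≢t → trans (cong (λ y → ⟦ (a == s ∧ y) ∧ c a b ⟧) (==-≢ b≢t))
                                            (cong (λ y → ⟦ y ∧ c a b ⟧) (∧-zeroʳ (a == s)))) ⟩
    ⟦ (a == s ∧ t == t) ∧ c a t ⟧  ≡⟨ cong (λ y → ⟦ (a == s ∧ y) ∧ c a t ⟧) (==-refl t) ⟩
    ⟦ (a == s ∧ true) ∧ c a t ⟧    ≡⟨ cong (λ y → ⟦ y ∧ c a t ⟧) (∧-identityʳ (a == s)) ⟩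
    ⟦ a == s ∧ c a t ⟧             ≡⟨ cong ⟦_⟧ (∧-==-at (λ a → c a t) a s) ⟩
    ⟦ a == s ∧ c s t ⟧             ∎

sum-rowCount-pair : ∀ {n} {p q : Fin n} → p ≢ q → ∀ c → sum (rowCount (pair p q) c) ≡ ⟦ c p q ⟧ + ⟦ c q p ⟧
sum-rowCount-pair {p = p} {q} p≢q c = begin
  sum (rowCount (pair p q) c)
    ≡⟨ sum-cong-≗ (rowCount-pair p≢q c) ⟩
  sum (λ a → ⟦ a == p ∧ c p q ⟧ + ⟦ a == q ∧ c q p ⟧)
    ≡⟨ ∑-distrib-+ (λ a → ⟦ a == p ∧ c p q ⟧) (λ a → ⟦ a == q ∧ c q p ⟧) ⟩
  sum (λ a → ⟦ a == p ∧ c p q ⟧) + sum (λ a → ⟦ a == q ∧ c q p ⟧)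
    ≡⟨ cong₂ _+_ (sum-==-∧ p (c p q)) (sum-==-∧ q (c q p)) ⟩
  ⟦ c p q ⟧ + ⟦ c q p ⟧ ∎
  where open ≡-Reasoning

module Exchange {n} (G : Graph n) (R A : Fin n → Fin n → Bool)
  (R-sym : ∀ a b → R a b ≡ R b a) (A-sym : ∀ a b → A a b ≡ A b a) (A-irrefl : ∀ a → A a a ≡ false)
  (R⊆G : ∀ {a b} → R a b ≡ true → adj G a b ≡ true)
  (A∩G=∅ : ∀ {a b} → A a b ≡ true → adj G a b ≡ false) where

  exchanged : Graph n
  exchanged = record { adj = adj′ ; sym = sym′ ; irrefl = irrefl′ }
    where
    adj′ : Fin n → Fin n → Bool
    adj′ a b = (adj G a b ∧ not (R a b)) ∨ A a b

    sym′ : ∀ a b → adj′ a b ≡ adj′ b a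
    sym′ a b rewrite Graph.sym G a b | R-sym a b | A-sym a b = refl

    irrefl′ : ∀ a → adj′ a a ≡ false
    irrefl′ a rewrite irrefl G a | A-irrefl a = refl

  rowCount-exchanged : ∀ c a →
    rowCount (adj exchanged) c a + rowCount R c a ≡ rowCount (adj G) c a + rowCount A c a
  rowCount-exchanged c a = begin
    rowCount (adj exchanged) c a + rowCount R c a
      ≡⟨ ∑-distrib-+ (λ b → ⟦ adj exchanged a b ∧ c a b ⟧) (λ b → ⟦ R a b ∧ c a b ⟧) ⟨
    sum (λ b → ⟦ adj exchanged a b ∧ c a b ⟧ + ⟦ R a b ∧ c a b ⟧)
      ≡⟨ sum-cong-≗ (λ b → point (adj G a b) (R a b) (A a b) (c a b) R⊆G A∩G=∅) ⟩
    sum (λ b → ⟦ adj G a b ∧ c a b ⟧ + ⟦ A a b ∧ c a b ⟧)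
      ≡⟨ ∑-distrib-+ (λ b → ⟦ adj G a b ∧ c a b ⟧) (λ b → ⟦ A a b ∧ c a b ⟧) ⟩
    rowCount (adj G) c a + rowCount A c a ∎
    where
    open ≡-Reasoning
    point : ∀ g r s z → (r ≡ true → g ≡ true) → (s ≡ true → g ≡ false) →
            ⟦ ((g ∧ not r) ∨ s) ∧ z ⟧ + ⟦ r ∧ z ⟧ ≡ ⟦ g ∧ z ⟧ + ⟦ s ∧ z ⟧
    point true  true  false z _ _ = sym (+-identityʳ ⟦ z ⟧)
    point true  false false z _ _ = refl
    point true  r     true  z _ s⇒¬g with s⇒¬g refl
    ... | ()
    point false true  s     z r⇒g _ with r⇒g refl
    ... | ()
    point false false s     z _ _ = +-identityʳ ⟦ s ∧ z ⟧

  rowCount-exchanged-≡ : ∀ c a → rowCount R c a ≡ rowCount A c a →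
                         rowCount (adj exchanged) c a ≡ rowCount (adj G) c a
  rowCount-exchanged-≡ c a R≡A =
    +-cancelʳ-≡ (rowCount R c a) _ _ (trans (rowCount-exchanged c a) (cong (rowCount (adj G) c a +_) (sym R≡A)))

  sum-rowCount-exchanged-≡ : ∀ c → sum (rowCount R c) ≡ sum (rowCount A c) →
                             sum (rowCount (adj exchanged) c) ≡ sum (rowCount (adj G) c)
  sum-rowCount-exchanged-≡ c R≡A = +-cancelʳ-≡ (sum (rowCount R c)) _ _ (begin
    sum (rowCount (adj exchanged) c) + sum (rowCount R c)
      ≡⟨ ∑-distrib-+ (rowCount (adj exchanged) c) (rowCount R c) ⟨
    sum (λ a → rowCount (adj exchanged) c a + rowCount R c a)
      ≡⟨ sum-cong-≗ (rowCount-exchanged c) ⟩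
    sum (λ a → rowCount (adj G) c a + rowCount A c a)
      ≡⟨ ∑-distrib-+ (rowCount (adj G) c) (rowCount A c) ⟩
    sum (rowCount (adj G) c) + sum (rowCount A c)
      ≡⟨ cong (sum (rowCount (adj G) c) +_) R≡A ⟨
    sum (rowCount (adj G) c) + sum (rowCount R c) ∎)
    where open ≡-Reasoning

module Switch {n} (G : Graph n) {u v w x : Fin n} (u≢v : u ≢ v) (v≢w : v ≢ w) (u≢x : u ≢ x)
  (uw∈G : adj G u w ≡ true) (vx∈G : adj G v x ≡ true)
  (vw∉G : adj G v w ≡ false) (ux∉G : adj G u x ≡ false) where

  u≢w : u ≢ w
  u≢w = adj⇒≢ G uw∈G

  v≢x : v ≢ x
  v≢x = adj⇒≢ G vx∈G

  removed added : Fin n → Fin n → Bool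
  removed a b = pair u w a b ∨ pair v x a b
  added   a b = pair v w a b ∨ pair u x a b

  removed-disjoint : ∀ a b → pair u w a b ∧ pair v x a b ≡ false
  removed-disjoint = pair-disjoint u≢v u≢x

  added-disjoint : ∀ a b → pair v w a b ∧ pair u x a b ≡ false
  added-disjoint = pair-disjoint (u≢v ∘ sym) v≢x

  open Exchange G removed added
    (λ a b → cong₂ _∨_ (pair-sym u w a b) (pair-sym v x a b))
    (λ a b → cong₂ _∨_ (pair-sym v w a b) (pair-sym u x a b))
    (λ a → cong₂ _∨_ (pair-irrefl v≢w a) (pair-irrefl u≢x a))
    (∨-elim (pair-⊆ G uw∈G) (pair-⊆ G vx∈G))
    (∨-elim (pair-⊆ G vw∉G) (pair-⊆ G ux∉G))
    public renaming (exchanged to switched)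

  rowCount-removed : ∀ c a → rowCount removed c a ≡
    ⟦ a == u ∧ c u w ⟧ + ⟦ a == w ∧ c w u ⟧ + (⟦ a == v ∧ c v x ⟧ + ⟦ a == x ∧ c x v ⟧)
  rowCount-removed c a = trans (rowCount-∨ (pair u w) (pair v x) c a (removed-disjoint a))
                               (cong₂ _+_ (rowCount-pair u≢w c a) (rowCount-pair v≢x c a))

  rowCount-added : ∀ c a → rowCount added c a ≡
    ⟦ a == v ∧ c v w ⟧ + ⟦ a == w ∧ c w v ⟧ + (⟦ a == u ∧ c u x ⟧ + ⟦ a == x ∧ c x u ⟧)
  rowCount-added c a = trans (rowCount-∨ (pair v w) (pair u x) c a (added-disjoint a))
                             (cong₂ _+_ (rowCount-pair v≢w c a) (rowCount-pair u≢x c a))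

  sum-rowCount-removed : ∀ c → sum (rowCount removed c) ≡ ⟦ c u w ⟧ + ⟦ c w u ⟧ + (⟦ c v x ⟧ + ⟦ c x v ⟧)
  sum-rowCount-removed c = trans (sum-rowCount-∨ (pair u w) (pair v x) c removed-disjoint)
                                 (cong₂ _+_ (sum-rowCount-pair u≢w c) (sum-rowCount-pair v≢x c))

  sum-rowCount-added : ∀ c → sum (rowCount added c) ≡ ⟦ c v w ⟧ + ⟦ c w v ⟧ + (⟦ c u x ⟧ + ⟦ c x u ⟧)
  sum-rowCount-added c = trans (sum-rowCount-∨ (pair v w) (pair u x) c added-disjoint)
                               (cong₂ _+_ (sum-rowCount-pair v≢w c) (sum-rowCount-pair u≢x c))

  degree-switched : ∀ a → degree switched a ≡ degree G a
  degree-switched a = begin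
    degree switched a                         ≡⟨ degree≡rowCount switched a ⟩
    rowCount (adj switched) (λ _ _ → true) a  ≡⟨ rowCount-exchanged-≡ (λ _ _ → true) a removed≡added ⟩
    rowCount (adj G) (λ _ _ → true) a         ≡⟨ degree≡rowCount G a ⟨
    degree G a                                ∎
    where
    open ≡-Reasoning
    swap : ∀ m n o p → m + n + (o + p) ≡ o + n + (m + p)
    swap = solve-∀

    removed≡added : rowCount removed (λ _ _ → true) a ≡ rowCount added (λ _ _ → true) a
    removed≡added = trans (rowCount-removed (λ _ _ → true) a) (trans
      (swap ⟦ a == u ∧ true ⟧ ⟦ a == w ∧ true ⟧ ⟦ a == v ∧ true ⟧ ⟦ a == x ∧ true ⟧)
      (sym (rowCount-added (λ _ _ → true) a)))

-- Switching inside a block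

module _ {n k : ℕ} (part : Fin n → Fin k) (D : Matrix* k) where

  inH : Fin n → Fin n → Bool
  inH a b = is-just (D (part a) (part b))

  inH-congˡ : ∀ {u v} b → part u ≡ part v → inH u b ≡ inH v b
  inH-congˡ b u~v = cong (λ i → is-just (D i (part b))) u~v

  inH-congʳ : ∀ {u v} a → part u ≡ part v → inH a u ≡ inH a v
  inH-congʳ a u~v = cong (λ j → is-just (D (part a) j)) u~v

  degreeH≡rowCount : ∀ G a → degreeH part D G a ≡ rowCount (adj G) inH a
  degreeH≡rowCount G a = count≡sum n _

  below : Fin n → Fin n → Bool
  below a b = ⌊ toℕ a <? toℕ b ⌋

  crossing : Fin k → Fin k → Fin n → Fin n → Bool
  crossing i j a b = below a b ∧ pair i j (part a) (part b)

  edgesBetween≡sum-rowCount : ∀ G i j → edgesBetween part G i j ≡ sum (rowCount (adj G) (crossing i j))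
  edgesBetween≡sum-rowCount G i j = trans (sumFin≡sum n _) (sum-cong-≗ λ a →
    trans (count≡sum n _) (sum-cong-≗ λ b → cong ⟦_⟧ (x∙yz≈y∙xz (below a b) (adj G a b) _)))

  -- Of the two orientations of a pair of distinct vertices exactly one is counted.
  crossing-pair : ∀ i j {p q} → p ≢ q →
                  ⟦ crossing i j p q ⟧ + ⟦ crossing i j q p ⟧ ≡ ⟦ pair i j (part p) (part q) ⟧
  crossing-pair i j {p} {q} p≢q rewrite pair-sym i j (part q) (part p) with toℕ p <? toℕ q | toℕ q <? toℕ p
  ... | yes p<q | yes q<p = ⊥-elim (<-asym p<q q<p)
  ... | yes _   | no  _   = +-identityʳ _
  ... | no  _   | yes _   = refl
  ... | no  p≮q | no  q≮p = ⊥-elim (p≢q (toℕ-injective (≤-antisym (≮⇒≥ q≮p) (≮⇒≥ p≮q))))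

  module BlockSwitch (G : Graph n) {u v w x : Fin n} (u≢v : u ≢ v) (v≢w : v ≢ w) (u≢x : u ≢ x)
    (uw∈G : adj G u w ≡ true) (vx∈G : adj G v x ≡ true)
    (vw∉G : adj G v w ≡ false) (ux∉G : adj G u x ≡ false) (u~v : part u ≡ part v) where

    open Switch G u≢v v≢w u≢x uw∈G vx∈G vw∉G ux∉G public

    edgesBetween-switched : ∀ i j → edgesBetween part switched i j ≡ edgesBetween part G i j
    edgesBetween-switched i j = begin
      edgesBetween part switched i j   ≡⟨ edgesBetween≡sum-rowCount switched i j ⟩
      sum (rowCount (adj switched) c)  ≡⟨ sum-rowCount-exchanged-≡ c removed≡added ⟩
      sum (rowCount (adj G) c)         ≡⟨ edgesBetween≡sum-rowCount G i j ⟨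
      edgesBetween part G i j          ∎
      where
      open ≡-Reasoning
      c : Fin n → Fin n → Bool
      c = crossing i j

      removed≡added : sum (rowCount removed c) ≡ sum (rowCount added c)
      removed≡added = begin
        sum (rowCount removed c)
          ≡⟨ sum-rowCount-removed c ⟩
        ⟦ c u w ⟧ + ⟦ c w u ⟧ + (⟦ c v x ⟧ + ⟦ c x v ⟧)
          ≡⟨ cong₂ _+_ (crossing-pair i j u≢w) (crossing-pair i j v≢x) ⟩
        ⟦ pair i j (part u) (part w) ⟧ + ⟦ pair i j (part v) (part x) ⟧
          ≡⟨ cong₂ (λ s t → ⟦ pair i j s (part w) ⟧ + ⟦ pair i j t (part x) ⟧) u~v (sym u~v) ⟩
        ⟦ pair i j (part v) (part w) ⟧ + ⟦ pair i j (part u) (part x) ⟧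
          ≡⟨ cong₂ _+_ (crossing-pair i j v≢w) (crossing-pair i j u≢x) ⟨
        ⟦ c v w ⟧ + ⟦ c w v ⟧ + (⟦ c u x ⟧ + ⟦ c x u ⟧)
          ≡⟨ sum-rowCount-added c ⟨
        sum (rowCount added c) ∎

    degreeH-switched : inH u w ≡ true → inH v x ≡ false →
                       ∀ a → degreeH part D switched a + ⟦ a == u ⟧ ≡ degreeH part D G a + ⟦ a == v ⟧
    degreeH-switched uw∈H vx∉H a = +-cancelʳ-≡ (W + X) _ _ (begin
      degreeH part D switched a + ⟦ a == u ⟧ + (W + X)
        ≡⟨ regroup (degreeH part D switched a) ⟦ a == u ⟧ W X ⟩
      degreeH part D switched a + (⟦ a == u ⟧ + W + X)
        ≡⟨ cong₂ _+_ (degreeH≡rowCount switched a) (sym removed-H) ⟩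
      rowCount (adj switched) inH a + rowCount removed inH a
        ≡⟨ rowCount-exchanged inH a ⟩
      rowCount (adj G) inH a + rowCount added inH a
        ≡⟨ cong₂ _+_ (sym (degreeH≡rowCount G a)) added-H ⟩
      degreeH part D G a + (⟦ a == v ⟧ + W + X)
        ≡⟨ regroup (degreeH part D G a) ⟦ a == v ⟧ W X ⟨
      degreeH part D G a + ⟦ a == v ⟧ + (W + X) ∎)
      where
      open ≡-Reasoning
      W X : ℕ
      W = ⟦ a == w ∧ inH w u ⟧
      X = ⟦ a == x ∧ inH x v ⟧

      regroup : ∀ m p q r → m + p + (q + r) ≡ m + (p + q + r)
      regroup = solve-∀

      ⟦∧true⟧ : ∀ {s t} → t ≡ true → ⟦ s ∧ t ⟧ ≡ ⟦ s ⟧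
      ⟦∧true⟧ {s} refl = cong ⟦_⟧ (∧-identityʳ s)

      ⟦∧false⟧ : ∀ {s t} → t ≡ false → ⟦ s ∧ t ⟧ ≡ 0
      ⟦∧false⟧ {s} refl = cong ⟦_⟧ (∧-zeroʳ s)

      removed-H : rowCount removed inH a ≡ ⟦ a == u ⟧ + W + X
      removed-H = trans (rowCount-removed inH a)
        (cong₂ _+_ (cong (_+ W) (⟦∧true⟧ uw∈H)) (cong (_+ X) (⟦∧false⟧ vx∉H)))

      added-H : rowCount added inH a ≡ ⟦ a == v ⟧ + W + X
      added-H = trans (rowCount-added inH a)
        (cong₂ _+_ (cong₂ _+_ (⟦∧true⟧ (trans (inH-congˡ w (sym u~v)) uw∈H))
                             (cong (λ t → ⟦ a == w ∧ t ⟧) (inH-congʳ w (sym u~v))))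
                   (cong₂ _+_ (⟦∧false⟧ (trans (inH-congˡ x u~v) vx∉H))
                             (cong (λ t → ⟦ a == x ∧ t ⟧) (inH-congʳ x u~v))))

  ∃-H-neighbour : ∀ G {u v} → part u ≡ part v → 2 + degreeH part D G v ≤ degreeH part D G u →
                  ∃ λ w → adj G u w ≡ true × adj G v w ≡ false × inH u w ≡ true × v ≢ w
  ∃-H-neighbour G {u} {v} u~v gap
    with count-gap⇒∃ n (λ b → adj G u b ∧ inH u b) (λ b → adj G v b ∧ inH v b) v gap
  ... | w , uw∈G∩H , vw∉G∩H , w≢v =
    w , ∧-conicalˡ _ _ uw∈G∩H , ∧-≡false (trans (inH-congˡ w (sym u~v)) uw∈H) vw∉G∩H , uw∈H , w≢v ∘ sym
    where
    uw∈H : inH u w ≡ true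
    uw∈H = ∧-conicalʳ _ _ uw∈G∩H

  ∃-non-H-neighbour : ∀ G {u v} → part u ≡ part v → degree G u ≡ degree G v →
                      2 + degreeH part D G v ≤ degreeH part D G u →
                      ∃ λ x → adj G v x ≡ true × adj G u x ≡ false × inH v x ≡ false × u ≢ x
  ∃-non-H-neighbour G {u} {v} u~v degree≡ gap
    with count-gap⇒∃ n (λ b → adj G v b ∧ not (inH v b)) (λ b → adj G u b ∧ not (inH u b)) u gap′
    where
    gap′ : 2 + count n (λ b → adj G u b ∧ not (inH u b)) ≤ count n (λ b → adj G v b ∧ not (inH v b))
    gap′ = complement-gap (trans (sym (count-split n (adj G u) (inH u)))
                                 (trans degree≡ (count-split n (adj G v) (inH v)))) gap
  ... | x , vx∈G∖H , ux∉G∖H , x≢u =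
    x , ∧-conicalˡ _ _ vx∈G∖H , ∧-≡false (cong not (trans (inH-congˡ x u~v) vx∉H)) ux∉G∖H , vx∉H , x≢u ∘ sym
    where
    vx∉H : inH v x ≡ false
    vx∉H = not-injective (∧-conicalʳ _ _ vx∈G∖H)

  Φ : Graph n → ℕ
  Φ G = sum (λ a → degreeH part D G a * degreeH part D G a)

  switch-step : ∀ {d G u v} → InClass part d D G → part u ≡ part v →
                2 + degreeH part D G v ≤ degreeH part D G u →
                ∃ λ G′ → InClass part d D G′ × Φ G′ < Φ G
  switch-step {d} {G} {u} {v} (degree≡d , edges≡D) u~v gap
    with ∃-H-neighbour G u~v gap
       | ∃-non-H-neighbour G u~v (trans (degree≡d u) (trans (cong d u~v) (sym (degree≡d v)))) gap
  ... | w , uw∈G , vw∉G , uw∈H , v≢w | x , vx∈G , ux∉G , vx∉H , u≢x =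
    switched ,
    ((λ a → trans (degree-switched a) (degree≡d a)) ,
     (λ i j m Dij≡m → trans (edgesBetween-switched i j) (edges≡D i j m Dij≡m))) ,
    sum-sq-transfer (degreeH part D G) (degreeH part D switched) (degreeH-switched uw∈H vx∉H) gap
    where
    u≢v : u ≢ v
    u≢v refl = 1+n≰n (≤-trans (n≤1+n _) gap)
    open BlockSwitch G u≢v v≢w u≢x uw∈G vx∈G vw∉G ux∉G u~v

  balancedAt? : ∀ G u v → Dec (part u ≡ part v → degreeH part D G u ≤ suc (degreeH part D G v))
  balancedAt? G u v = (part u ≟ part v) →-dec (degreeH part D G u ≤? suc (degreeH part D G v))

  balanced? : ∀ G → Balanced part D G ⊎
              ∃ λ u → ∃ λ v → part u ≡ part v × 2 + degreeH part D G v ≤ degreeH part D G u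
  balanced? G with all? (λ u → all? (balancedAt? G u))
  ... | yes balanced = inj₁ balanced
  ... | no ¬balanced with ¬∀⟶∃¬ n _ (λ u → all? (balancedAt? G u)) ¬balanced
  ...   | u , ¬balanced-u with ¬∀⟶∃¬ n _ (balancedAt? G u) ¬balanced-u
  ...     | v , ¬balanced-uv with part u ≟ part v
  ...       | yes u~v = inj₂ (u , v , u~v , ≰⇒> (λ le → ¬balanced-uv (λ _ → le)))
  ...       | no  u≁v = ⊥-elim (¬balanced-uv (⊥-elim ∘ u≁v))

  balance : ∀ {d} G → Acc _<_ (Φ G) → InClass part d D G →
            ∃ λ G′ → InClass part d D G′ × Balanced part D G′
  balance {d} G (acc smaller) G∈ with balanced? G
  ... | inj₁ balanced = G , G∈ , balanced
  ... | inj₂ (u , v , u~v , gap) =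
    let G′ , G′∈ , Φ′<Φ = switch-step {d} {G} G∈ u~v gap in balance {d} G′ (smaller Φ′<Φ) G′∈

lemma1 : (n k : ℕ) (part : Fin n → Fin k) →
         (∀ i → ∃ λ v → part v ≡ i) →
         (d : Fin k → ℕ) (D : Matrix* k) →
         (∀ i j → D i j ≡ D j i) →
         (∃ λ G → InClass part d D G) →
         ∃ λ G → InClass part d D G × Balanced part D G
lemma1 n k part _ d D _ (G , G∈) = balance part D {d} G (<-wellFounded (Φ part D G)) G∈
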